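{- Let $U$ be a positive integer and let $X \subseteq \{ -U, \ldots, U\}$ be a set of nonzero integers. Then \[ \sum_{x, y \in X} \frac{1}{H(x/y)} \le O(U \log U). \]
   Context: For a nonzero rational number $r$, its height $H(r)$ is defined as $\max(|a|,|b|)$ where $r = a/b$ with $a,b$ coprime integers. -}

module Defs where

open import Data.Nat as ℕ using (ℕ; zero; suc; _⊔_)
open import Data.Nat.Properties using (m≤n⇒m≤o⊔n; ≤-refl)
open import Data.Integer as ℤ using (ℤ; +_; -[1+_]; ∣_∣)
open import Data.Rational as ℚ using (ℚ; mkℚ; _/_; ↥_; ↧ₙ_; 0ℚ; _+_)
open import Data.List using (List; foldr; map; concatMap)

-- the rational number x / y for integers x, y (with the junk value 0 when y = 0)
_/ℤ_ : ℤ → ℤ → ℚ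
x /ℤ (+ zero)   = 0ℚ
x /ℤ (+ suc n)  = x / suc n
x /ℤ -[1+ n ]   = (ℤ.- x) / suc n

H : ℚ → ℕ
H r = ∣ ↥ r ∣ ⊔ ↧ₙ r

H-nonZero : ∀ r → ℕ.NonZero (H r)
H-nonZero (mkℚ n d c) = ℕ.>-nonZero (m≤n⇒m≤o⊔n ∣ n ∣ (ℕ.s≤s ℕ.z≤n))

invH : ℚ → ℚ
invH r = (+ 1 / H r) {{H-nonZero r}}

sumℚ : List ℚ → ℚ
sumℚ = foldr _+_ 0ℚ

heightSum : List ℤ → ℚ
heightSum X = sumℚ (concatMap (λ x → map (λ y → invH (x /ℤ y)) X) X)

-- Multiplying by D = U! turns each term 1 / H(x/y) into the natural number D / H(x/y), so the claim
-- becomes a bound on a sum of naturals. Signs do not matter, which costs a factor 4. Writing a / b in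
-- lowest terms as g p / g q with g = gcd a b, the map (a , b) ↦ (g , p , q) is injective into the
-- triples with g ≤ U and p , q ≤ U / g, and H(a/b) = max(p , q). Hence the sum over 1 ≤ a , b ≤ U is at
-- most ∑_{g ≤ U} ∑_{p , q ≤ U/g} 1 / max(p , q), whose inner sum is ∑_{m ≤ N} (2m - 1) / m ≤ 2N.
-- Finally ∑_{g ≤ U} ⌊U/g⌋ ≤ U (1 + ⌊log₂ U⌋), since the terms g = 2j and g = 2j + 1 together are at most
-- the term g = j.

module Submission where

open import Defs
open import Data.Nat as ℕ using (ℕ; _*_; _≥_)
open import Data.Nat.Logarithm using (⌊log₂_⌋)
open import Data.Integer as ℤ using (ℤ; +_; ∣_∣)
open import Data.Rational as ℚ using (_/_)
open import Data.List using (List)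
open import Data.List.Relation.Unary.All using (All)
open import Data.List.Relation.Unary.Unique.Propositional using (Unique)
open import Data.Product using (Σ; _×_)
open import Relation.Binary.PropositionalEquality using (_≢_)

open import Data.Nat
  using (zero; suc; pred; _+_; _≤_; _<_; _⊔_; _!; ⌊_/2⌋; ⌈_/2⌉; NonZero; z≤n; z<s)
open import Data.Nat.Properties
open import Data.Nat.DivMod using (n/1≡n; m/n*n≤m; m/n*n≡m; m*n/n≡m; /-monoˡ-≤)
open import Data.Nat.Divisibility using (_∣_; divides; quotient; 0∣⇒≡0; ∣⇒≤; ∣-trans; m≤n⇒m!∣n!; m∣m*n)
open import Data.Nat.GCD using (gcd; gcd[m,n]∣m; gcd[m,n]∣n; gcd[m,n]≢0)
open import Data.Nat.Induction using (<-wellFounded)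
open import Data.Nat.ListAction using (sum)
open import Data.Nat.ListAction.Properties using (sum-++; sum-↭)
open import Data.Nat.Logarithm.Core using (⌊log2⌋)
open import Data.Nat.Solver using (module +-*-Solver)
open import Algebra.Properties.CommutativeSemigroup +-commutativeSemigroup
  using () renaming (interchange to +-interchange)
import Data.Integer.Properties as ℤ
open import Data.Rational using (ℚ; toℚᵘ; ↥_; ↧ₙ_)
import Data.Rational.Properties as ℚ
open import Data.Rational.Unnormalised as ℚᵘ using (mkℚᵘ; *≤*)
import Data.Rational.Unnormalised.Properties as ℚᵘ
open import Data.List using ([]; _∷_; _++_; map; concatMap; cartesianProduct; length; downFrom)
open import Data.List.Properties using (map-++; map-∘; map-cong; map-cong-local; length-map; length-downFrom)
open import Data.List.Membership.Propositional using (_∈_; lose)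
open import Data.List.Membership.Propositional.Properties
  using (∈-map⁺; ∈-map⁻; ∈-∃++; ∈-concatMap⁺; ∈-cartesianProduct⁺; ∈-cartesianProduct⁻; ∈-downFrom⁺; ∈-downFrom⁻)
open import Data.List.Relation.Binary.Permutation.Propositional.Properties using (shift; ∈-resp-↭)
import Data.List.Relation.Binary.Permutation.Propositional.Properties as ↭
open import Data.List.Relation.Unary.All using ([]; _∷_)
import Data.List.Relation.Unary.All as All
import Data.List.Relation.Unary.All.Properties as All
open import Data.List.Relation.Unary.Any using (here; there)
import Data.List.Relation.Unary.Any as Any
open import Data.List.Relation.Unary.Unique.Propositional using (_∷_)
open import Data.List.Relation.Unary.Unique.Propositional.Properties using (map⁺; cartesianProduct⁺; downFrom⁺)
open import Data.Product using (_,_; proj₁; proj₂; uncurry)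
import Data.Product as Product
open import Data.Sum using (inj₁; inj₂)
open import Data.Empty using (⊥-elim)
open import Function using (_∘_)
open import Induction.WellFounded using (Acc; acc)
open import Relation.Binary.PropositionalEquality using (_≡_; refl; sym; trans; cong; cong₂; subst; subst₂; module ≡-Reasoning)

variable
  A B C : Set

-- Floor division with the junk value m ÷ 0 = 0, so that it can be mapped over lists

infixl 7 _÷_

_÷_ : ℕ → ℕ → ℕ
m ÷ zero  = 0
m ÷ suc n = m ℕ./ suc n

m÷n*n≤m : ∀ m n → m ÷ n * n ≤ m
m÷n*n≤m m zero    = z≤n
m÷n*n≤m m (suc n) = m/n*n≤m m (suc n)

m÷n*n≡m : ∀ {m n} → n ∣ m → m ÷ n * n ≡ m
m÷n*n≡m {n = zero}  0∣m = sym (0∣⇒≡0 0∣m)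
m÷n*n≡m {n = suc n} n∣m = m/n*n≡m n∣m

m*n≤o⇒m≤o÷n : ∀ {m n o} → 0 < n → m * n ≤ o → m ≤ o ÷ n
m*n≤o⇒m≤o÷n {m} {suc n} {o} _ m*n≤o = begin
  m                   ≡⟨ m*n/n≡m m (suc n) ⟨
  m * suc n ℕ./ suc n ≤⟨ /-monoˡ-≤ (suc n) m*n≤o ⟩
  o ℕ./ suc n         ∎
  where open ≤-Reasoning

÷-antimonoʳ-≤ : ∀ m {n o} → 0 < n → n ≤ o → m ÷ o ≤ m ÷ n
÷-antimonoʳ-≤ m {n} {o} 0<n n≤o = m*n≤o⇒m≤o÷n 0<n (≤-trans (*-monoʳ-≤ (m ÷ o) n≤o) (m÷n*n≤m m o))

m÷[k+k]+m÷[k+k]≤m÷k : ∀ m k → m ÷ (k + k) + m ÷ (k + k) ≤ m ÷ k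
m÷[k+k]+m÷[k+k]≤m÷k m zero      = z≤n
m÷[k+k]+m÷[k+k]≤m÷k m k@(suc _) = m*n≤o⇒m≤o÷n z<s (begin
  (q + q) * k  ≡⟨ *-distribʳ-+ k q q ⟩
  q * k + q * k ≡⟨ *-distribˡ-+ q k k ⟨
  q * (k + k)  ≤⟨ m÷n*n≤m m (k + k) ⟩
  m            ∎)
  where
  open ≤-Reasoning
  q = m ÷ (k + k)

sum-map-mono : ∀ {f g : A → ℕ} {xs} → All (λ x → f x ≤ g x) xs → sum (map f xs) ≤ sum (map g xs)
sum-map-mono []                = z≤n
sum-map-mono (fx≤gx ∷ fxs≤gxs) = +-mono-≤ fx≤gx (sum-map-mono fxs≤gxs)

sum-map-cong : ∀ {f g : A → ℕ} {xs} → All (λ x → f x ≡ g x) xs → sum (map f xs) ≡ sum (map g xs)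
sum-map-cong = cong sum ∘ map-cong-local

sum-map-+ : ∀ (f g : A → ℕ) xs → sum (map (λ x → f x + g x) xs) ≡ sum (map f xs) + sum (map g xs)
sum-map-+ f g []       = refl
sum-map-+ f g (x ∷ xs) =
  trans (cong (_+_ (f x + g x)) (sum-map-+ f g xs)) (+-interchange (f x) (g x) _ _)

sum-map-*ˡ : ∀ k (f : A → ℕ) xs → sum (map (λ x → k * f x) xs) ≡ k * sum (map f xs)
sum-map-*ˡ k f []       = sym (*-zeroʳ k)
sum-map-*ˡ k f (x ∷ xs) = trans (cong (_+_ (k * f x)) (sum-map-*ˡ k f xs)) (sym (*-distribˡ-+ k (f x) _))

sum-map-const : ∀ c (xs : List A) → sum (map (λ _ → c) xs) ≡ length xs * c
sum-map-const c []       = refl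
sum-map-const c (x ∷ xs) = cong (_+_ c) (sum-map-const c xs)

sum-concatMap : ∀ (f : B → ℕ) (g : A → List B) xs →
                sum (map f (concatMap g xs)) ≡ sum (map (λ x → sum (map f (g x))) xs)
sum-concatMap f g []       = refl
sum-concatMap f g (x ∷ xs) = begin
  sum (map f (g x ++ concatMap g xs))              ≡⟨ cong sum (map-++ f (g x) (concatMap g xs)) ⟩
  sum (map f (g x) ++ map f (concatMap g xs))      ≡⟨ sum-++ (map f (g x)) _ ⟩
  sum (map f (g x)) + sum (map f (concatMap g xs)) ≡⟨ cong (_+_ (sum (map f (g x)))) (sum-concatMap f g xs) ⟩
  sum (map f (g x)) + sum (map (λ x → sum (map f (g x))) xs) ∎
  where open ≡-Reasoning

concatMap-map≡map-cartesianProduct : ∀ (f : A → B → C) xs ys →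
  concatMap (λ x → map (f x) ys) xs ≡ map (uncurry f) (cartesianProduct xs ys)
concatMap-map≡map-cartesianProduct f []       ys = refl
concatMap-map≡map-cartesianProduct f (x ∷ xs) ys = begin
  map (f x) ys ++ concatMap (λ x → map (f x) ys) xs
    ≡⟨ cong₂ _++_ (map-∘ ys) (concatMap-map≡map-cartesianProduct f xs ys) ⟩
  map (uncurry f) (map (x ,_) ys) ++ map (uncurry f) (cartesianProduct xs ys)
    ≡⟨ map-++ (uncurry f) (map (x ,_) ys) (cartesianProduct xs ys) ⟨
  map (uncurry f) (cartesianProduct (x ∷ xs) ys) ∎
  where open ≡-Reasoning

sum-cartesianProduct : ∀ (f : A × B → ℕ) xs ys →
  sum (map f (cartesianProduct xs ys)) ≡ sum (map (λ x → sum (map (λ y → f (x , y)) ys)) xs)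
sum-cartesianProduct f []       ys = refl
sum-cartesianProduct f (x ∷ xs) ys = begin
  sum (map f (map (x ,_) ys ++ cartesianProduct xs ys))
    ≡⟨ cong sum (map-++ f (map (x ,_) ys) (cartesianProduct xs ys)) ⟩
  sum (map f (map (x ,_) ys) ++ map f (cartesianProduct xs ys))
    ≡⟨ sum-++ (map f (map (x ,_) ys)) _ ⟩
  sum (map f (map (x ,_) ys)) + sum (map f (cartesianProduct xs ys))
    ≡⟨ cong₂ _+_ (cong sum (sym (map-∘ ys))) (sum-cartesianProduct f xs ys) ⟩
  sum (map (λ y → f (x , y)) ys) + sum (map (λ x → sum (map (λ y → f (x , y)) ys)) xs) ∎
  where open ≡-Reasoning

sum-map-mono-⊆ : ∀ (f : A → ℕ) {xs ys} → Unique xs → All (_∈ ys) xs → sum (map f xs) ≤ sum (map f ys)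
sum-map-mono-⊆ f {[]}     _              _                = z≤n
sum-map-mono-⊆ f {x ∷ xs} (x∉xs ∷ xs-unique) (x∈ys ∷ xs⊆ys)
  with as , bs , refl ← ∈-∃++ x∈ys = begin
  f x + sum (map f xs)          ≤⟨ +-monoʳ-≤ (f x) (sum-map-mono-⊆ f xs-unique (All.zipWith drop-x (x∉xs , xs⊆ys))) ⟩
  f x + sum (map f (as ++ bs))  ≡⟨ sum-↭ (↭.map⁺ f (shift x as bs)) ⟨
  sum (map f (as ++ x ∷ bs))    ∎
  where
  open ≤-Reasoning
  drop-x : ∀ {z} → x ≢ z × z ∈ as ++ x ∷ bs → z ∈ as ++ bs
  drop-x (x≢z , z∈) = Any.tail (λ z≡x → x≢z (sym z≡x)) (∈-resp-↭ (shift x as bs) z∈)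

oneTo : ℕ → List ℕ
oneTo n = map suc (downFrom n)

length-oneTo : ∀ n → length (oneTo n) ≡ n
length-oneTo n = trans (length-map suc (downFrom n)) (length-downFrom n)

oneTo-unique : ∀ n → Unique (oneTo n)
oneTo-unique n = map⁺ suc-injective (downFrom⁺ n)

∈-oneTo⁺ : ∀ {k n} → 0 < k → k ≤ n → k ∈ oneTo n
∈-oneTo⁺ {suc k} _ k<n = ∈-map⁺ suc (∈-downFrom⁺ k<n)

∈-oneTo⁻ : ∀ {k n} → k ∈ oneTo n → 0 < k × k ≤ n
∈-oneTo⁻ k∈ with _ , j∈ , refl ← ∈-map⁻ suc k∈ = z<s , ∈-downFrom⁻ j∈

sum-map-oneTo-mono : ∀ (f : ℕ → ℕ) {m n} → m ≤ n → sum (map f (oneTo m)) ≤ sum (map f (oneTo n))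
sum-map-oneTo-mono f m≤n = sum-map-mono-⊆ f (oneTo-unique _) (All.tabulate λ k∈ →
  let 0<k , k≤m = ∈-oneTo⁻ k∈ in ∈-oneTo⁺ 0<k (≤-trans k≤m m≤n))

sum-map-oneTo-const : ∀ {f : ℕ → ℕ} {c} n → (∀ {k} → k ≤ n → f k ≡ c) → sum (map f (oneTo n)) ≡ n * c
sum-map-oneTo-const {f} {c} n f≡c = begin
  sum (map f (oneTo n))           ≡⟨ sum-map-cong (All.tabulate (f≡c ∘ proj₂ ∘ ∈-oneTo⁻)) ⟩
  sum (map (λ _ → c) (oneTo n))   ≡⟨ sum-map-const c (oneTo n) ⟩
  length (oneTo n) * c            ≡⟨ cong (_* c) (length-oneTo n) ⟩
  n * c                           ∎
  where open ≡-Reasoning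

signedOneTo : ℕ → List ℤ
signedOneTo zero    = []
signedOneTo (suc n) = + suc n ∷ ℤ.-[1+ n ] ∷ signedOneTo n

∈-signedOneTo⁺ : ∀ {n} x → x ≢ + 0 → ∣ x ∣ ≤ n → x ∈ signedOneTo n
∈-signedOneTo⁺ (+ zero) x≢0 _ = ⊥-elim (x≢0 refl)
∈-signedOneTo⁺ {suc n} (+ suc k) _ k<1+n with m≤n⇒m<n∨m≡n k<1+n
... | inj₁ k<n  = there (there (∈-signedOneTo⁺ (+ suc k) (λ ()) (≤-pred k<n)))
... | inj₂ refl = here refl
∈-signedOneTo⁺ {suc n} ℤ.-[1+ k ] _ k<1+n with m≤n⇒m<n∨m≡n k<1+n
... | inj₁ k<n  = there (there (∈-signedOneTo⁺ ℤ.-[1+ k ] (λ ()) (≤-pred k<n)))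
... | inj₂ refl = there (here refl)

sum-map-signedOneTo : ∀ (f : ℕ → ℕ) n → sum (map (f ∘ ∣_∣) (signedOneTo n)) ≡ 2 * sum (map f (oneTo n))
sum-map-signedOneTo f zero    = refl
sum-map-signedOneTo f (suc n) = begin
  f (suc n) + (f (suc n) + sum (map (f ∘ ∣_∣) (signedOneTo n)))
    ≡⟨ cong (λ s → f (suc n) + (f (suc n) + s)) (sum-map-signedOneTo f n) ⟩
  f (suc n) + (f (suc n) + 2 * sum (map f (oneTo n)))
    ≡⟨ solve 2 (λ a s → a :+ (a :+ con 2 :* s) := con 2 :* (a :+ s)) refl (f (suc n)) _ ⟩
  2 * (f (suc n) + sum (map f (oneTo n))) ∎
  where
  open ≡-Reasoning
  open +-*-Solver

Hℕ : ℕ × ℕ → ℕ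
Hℕ (a , b) = H ((+ a) /ℤ (+ b))

H-neg : ∀ p → H (ℚ.- p) ≡ H p
H-neg (ℚ.mkℚ (+ zero)     _ _) = refl
H-neg (ℚ.mkℚ (+ suc _)    _ _) = refl
H-neg (ℚ.mkℚ ℤ.-[1+ _ ]   _ _) = refl

H-/-abs : ∀ x n .{{_ : NonZero n}} → H (x / n) ≡ H (+ ∣ x ∣ / n)
H-/-abs (+ _)      n = refl
H-/-abs ℤ.-[1+ m ] n = H-neg (+ suc m / n)

H-/ℤ : ∀ x y → H (x /ℤ y) ≡ Hℕ (∣ x ∣ , ∣ y ∣)
H-/ℤ x (+ zero)     = refl
H-/ℤ x (+ suc n)    = H-/-abs x (suc n)
H-/ℤ x ℤ.-[1+ n ]   = trans (H-/-abs (ℤ.- x) (suc n)) (cong (λ a → Hℕ (a , suc n)) (ℤ.∣-i∣≡∣i∣ x))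

-- (a , b) ↦ (gcd a b , a / gcd a b , b / gcd a b), written with the cofactors of the gcd so that it
-- is injective even where gcd a b = 0
splitGcd : ℕ × ℕ → ℕ × ℕ × ℕ
splitGcd (a , b) = gcd a b , quotient (gcd[m,n]∣m a b) , quotient (gcd[m,n]∣n a b)

cofactorMax : ℕ × ℕ × ℕ → ℕ
cofactorMax (_ , p , q) = p ⊔ q

splitGcd-injective : ∀ {z w} → splitGcd z ≡ splitGcd w → z ≡ w
splitGcd-injective {a , b} {c , d} eq = cong₂ _,_
  (recover (gcd[m,n]∣m a b) (gcd[m,n]∣m c d) (cong proj₁ eq) (cong (proj₁ ∘ proj₂) eq))
  (recover (gcd[m,n]∣n a b) (gcd[m,n]∣n c d) (cong proj₁ eq) (cong (proj₂ ∘ proj₂) eq))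
  where
  recover : ∀ {g h m n} (g∣m : g ∣ m) (h∣n : h ∣ n) → g ≡ h → quotient g∣m ≡ quotient h∣n → m ≡ n
  recover (divides p refl) (divides .p refl) refl refl = refl

Hℕ-splitGcd : ∀ a b → 0 < b → Hℕ (a , b) ≡ cofactorMax (splitGcd (a , b))
Hℕ-splitGcd a b@(suc _) _ = begin
  H r                 ≡⟨⟩
  ∣ ↥ r ∣ ⊔ ↧ₙ r      ≡⟨ cong₂ _⊔_ (*-cancelʳ-≡ ∣ ↥ r ∣ p g numerator) (*-cancelʳ-≡ (↧ₙ r) q g denominator) ⟩
  cofactorMax (splitGcd (a , b)) ∎
  where
  open ≡-Reasoning
  r = + a / b
  g = gcd a b
  p = quotient (gcd[m,n]∣m a b)
  q = quotient (gcd[m,n]∣n a b)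
  instance
    g≢0 : NonZero g
    g≢0 = ℕ.≢-nonZero (gcd[m,n]≢0 a b (inj₂ λ ()))
  numerator : ∣ ↥ r ∣ * g ≡ p * g
  numerator = trans (sym (ℤ.abs-* (↥ r) (+ g)))
                    (trans (cong ∣_∣ (ℚ.↥-/ (+ a) b)) (_∣_.equality (gcd[m,n]∣m a b)))
  denominator : ↧ₙ r * g ≡ q * g
  denominator = trans (ℤ.+-injective (trans (ℤ.pos-* (↧ₙ r) g) (ℚ.↧-/ (+ a) b)))
                      (_∣_.equality (gcd[m,n]∣n a b))

quotient-≤ : ∀ {d m} .{{_ : NonZero d}} (d∣m : d ∣ m) → quotient d∣m ≤ m
quotient-≤ {d} (divides q refl) = m≤m*n q d

Hℕ-≤ : ∀ a b → 0 < b → Hℕ (a , b) ≤ a ⊔ b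
Hℕ-≤ a b 0<b = ≤-trans (≤-reflexive (Hℕ-splitGcd a b 0<b))
  (⊔-mono-≤ (quotient-≤ (gcd[m,n]∣m a b)) (quotient-≤ (gcd[m,n]∣n a b)))
  where
  instance
    g≢0 : NonZero (gcd a b)
    g≢0 = ℕ.≢-nonZero (gcd[m,n]≢0 a b (inj₂ (>⇒≢ 0<b)))

square : List A → List (A × A)
square xs = cartesianProduct xs xs

boxes : ℕ → List (ℕ × ℕ × ℕ)
boxes U = concatMap (λ d → map (d ,_) (square (oneTo (U ÷ d)))) (oneTo U)

quotient-∈-oneTo : ∀ {d m n} (d∣m : d ∣ m) → 0 < m → m ≤ n → quotient d∣m ∈ oneTo (n ÷ d)
quotient-∈-oneTo {d} (divides q refl) 0<m m≤n =
  ∈-oneTo⁺ (ℕ.>-nonZero⁻¹ q {{m*n≢0⇒m≢0 q}}) (m*n≤o⇒m≤o÷n (ℕ.>-nonZero⁻¹ d {{m*n≢0⇒n≢0 q}}) m≤n)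
  where instance _ = ℕ.>-nonZero 0<m

splitGcd-∈-boxes : ∀ {a b U} → a ∈ oneTo U → b ∈ oneTo U → splitGcd (a , b) ∈ boxes U
splitGcd-∈-boxes {a} {b} {U} a∈ b∈ =
  ∈-concatMap⁺ (λ d → map (d ,_) (square (oneTo (U ÷ d))))
    (lose g∈ (∈-map⁺ (g ,_) (∈-cartesianProduct⁺ (quotient-∈-oneTo (gcd[m,n]∣m a b) 0<a a≤U)
                                                   (quotient-∈-oneTo (gcd[m,n]∣n a b) 0<b b≤U))))
  where
  0<a = proj₁ (∈-oneTo⁻ a∈)
  a≤U = proj₂ (∈-oneTo⁻ a∈)
  0<b = proj₁ (∈-oneTo⁻ b∈)
  b≤U = proj₂ (∈-oneTo⁻ b∈)
  g = gcd a b
  g∈ : g ∈ oneTo U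
  g∈ = ∈-oneTo⁺ (n≢0⇒n>0 (gcd[m,n]≢0 a b (inj₁ (>⇒≢ 0<a))))
                (≤-trans (∣⇒≤ {{ℕ.>-nonZero 0<a}} (gcd[m,n]∣m a b)) a≤U)

sum-square-Hℕ-≤-boxes : ∀ (f : ℕ → ℕ) U →
  sum (map (f ∘ Hℕ) (square (oneTo U)))
    ≤ sum (map (λ d → sum (map (f ∘ uncurry _⊔_) (square (oneTo (U ÷ d))))) (oneTo U))
sum-square-Hℕ-≤-boxes f U = begin
  sum (map (f ∘ Hℕ) (square R))
    ≡⟨ sum-map-cong (All.tabulate Hℕ≡cofactorMax) ⟩
  sum (map (f ∘ cofactorMax ∘ splitGcd) (square R))
    ≡⟨ cong sum (map-∘ (square R)) ⟩
  sum (map (f ∘ cofactorMax) (map splitGcd (square R)))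
    ≤⟨ sum-map-mono-⊆ (f ∘ cofactorMax) (map⁺ splitGcd-injective (cartesianProduct⁺ (oneTo-unique U) (oneTo-unique U)))
         (All.map⁺ (All.tabulate λ z∈ → uncurry splitGcd-∈-boxes (∈-cartesianProduct⁻ R R z∈))) ⟩
  sum (map (f ∘ cofactorMax) (boxes U))
    ≡⟨ sum-concatMap (f ∘ cofactorMax) (λ d → map (d ,_) (square (oneTo (U ÷ d)))) R ⟩
  sum (map (λ d → sum (map (f ∘ cofactorMax) (map (d ,_) (square (oneTo (U ÷ d)))))) R)
    ≡⟨ cong sum (map-cong (λ d → cong sum (sym (map-∘ (square (oneTo (U ÷ d)))))) R) ⟩
  sum (map (λ d → sum (map (f ∘ uncurry _⊔_) (square (oneTo (U ÷ d))))) R) ∎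
  where
  open ≤-Reasoning
  R = oneTo U
  Hℕ≡cofactorMax : ∀ {z} → z ∈ square R → f (Hℕ z) ≡ f (cofactorMax (splitGcd z))
  Hℕ≡cofactorMax {a , b} z∈ = cong f (Hℕ-splitGcd a b (proj₁ (∈-oneTo⁻ (proj₂ (∈-cartesianProduct⁻ R R z∈)))))

sum-square-abs-≤ : ∀ (f : ℕ × ℕ → ℕ) U {X} → Unique X → All (λ x → x ≢ + 0 × ∣ x ∣ ≤ U) X →
  sum (map (f ∘ Product.map ∣_∣ ∣_∣) (square X)) ≤ 4 * sum (map f (square (oneTo U)))
sum-square-abs-≤ f U {X} X-unique X-bounded = begin
  sum (map F (square X))
    ≤⟨ sum-map-mono-⊆ F (cartesianProduct⁺ X-unique X-unique) (All.tabulate λ z∈ →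
         let x∈ , y∈ = ∈-cartesianProduct⁻ X X z∈ in ∈-cartesianProduct⁺ (∈-S x∈) (∈-S y∈)) ⟩
  sum (map F (square S))
    ≡⟨ sum-cartesianProduct F S S ⟩
  sum (map (λ x → sum (map (λ y → f (∣ x ∣ , ∣ y ∣)) S)) S)
    ≡⟨ cong sum (map-cong (λ x → sum-map-signedOneTo (λ b → f (∣ x ∣ , b)) U) S) ⟩
  sum (map (λ x → 2 * sum (map (λ b → f (∣ x ∣ , b)) R)) S)
    ≡⟨ sum-map-signedOneTo (λ a → 2 * sum (map (λ b → f (a , b)) R)) U ⟩
  2 * sum (map (λ a → 2 * sum (map (λ b → f (a , b)) R)) R)
    ≡⟨ cong (2 *_) (sum-map-*ˡ 2 (λ a → sum (map (λ b → f (a , b)) R)) R) ⟩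
  2 * (2 * sum (map (λ a → sum (map (λ b → f (a , b)) R)) R))
    ≡⟨ *-assoc 2 2 (sum (map (λ a → sum (map (λ b → f (a , b)) R)) R)) ⟨
  4 * sum (map (λ a → sum (map (λ b → f (a , b)) R)) R)
    ≡⟨ cong (4 *_) (sum-cartesianProduct f R R) ⟨
  4 * sum (map f (square R)) ∎
  where
  open ≤-Reasoning
  F = f ∘ Product.map ∣_∣ ∣_∣
  R = oneTo U
  S = signedOneTo U
  ∈-S : ∀ {x} → x ∈ X → x ∈ S
  ∈-S x∈ = let x≢0 , ∣x∣≤U = All.lookup X-bounded x∈ in ∈-signedOneTo⁺ _ x≢0 ∣x∣≤U

sum-square-⊔ : ∀ (f : ℕ → ℕ) N →
  sum (map (f ∘ uncurry _⊔_) (square (oneTo N))) ≡ sum (map (λ m → (m + pred m) * f m) (oneTo N))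
sum-square-⊔ f N = trans (sum-cartesianProduct (f ∘ uncurry _⊔_) (oneTo N) (oneTo N)) (shells N)
  where
  shells : ∀ N → sum (map (λ p → sum (map (λ q → f (p ⊔ q)) (oneTo N))) (oneTo N))
                 ≡ sum (map (λ m → (m + pred m) * f m) (oneTo N))
  shells zero    = refl
  shells (suc N) = begin
    (f (suc N ⊔ suc N) + sum (map (λ q → f (suc N ⊔ q)) R))
      + sum (map (λ p → f (p ⊔ suc N) + sum (map (λ q → f (p ⊔ q)) R)) R)
        ≡⟨ cong₂ _+_ (cong₂ _+_ (cong f (⊔-idem (suc N))) row) (sum-map-+ (λ p → f (p ⊔ suc N)) _ R) ⟩
    (a + N * a) + (sum (map (λ p → f (p ⊔ suc N)) R) + sum (map (λ p → sum (map (λ q → f (p ⊔ q)) R)) R))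
        ≡⟨ cong₂ (λ s t → (a + N * a) + (s + t)) column (shells N) ⟩
    (a + N * a) + (N * a + sum (map (λ m → (m + pred m) * f m) R))
        ≡⟨ solve 3 (λ a n s → (a :+ n :* a) :+ (n :* a :+ s) := (con 1 :+ n :+ n) :* a :+ s) refl a N _ ⟩
    (suc N + N) * a + sum (map (λ m → (m + pred m) * f m) R) ∎
    where
    open ≡-Reasoning
    open +-*-Solver
    R = oneTo N
    a = f (suc N)
    row : sum (map (λ q → f (suc N ⊔ q)) R) ≡ N * a
    row = sum-map-oneTo-const N λ q≤N → cong f (m≥n⇒m⊔n≡m (m≤n⇒m≤1+n q≤N))
    column : sum (map (λ p → f (p ⊔ suc N)) R) ≡ N * a
    column = sum-map-oneTo-const N λ p≤N → cong f (m≤n⇒m⊔n≡n (m≤n⇒m≤1+n p≤N))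

sum-square-÷⊔-≤ : ∀ D N → sum (map ((D ÷_) ∘ uncurry _⊔_) (square (oneTo N))) ≤ (D + D) * N
sum-square-÷⊔-≤ D N = begin
  sum (map ((D ÷_) ∘ uncurry _⊔_) (square (oneTo N)))  ≡⟨ sum-square-⊔ (D ÷_) N ⟩
  sum (map (λ m → (m + pred m) * (D ÷ m)) (oneTo N))    ≤⟨ sum-map-mono {xs = oneTo N} (All.tabulate λ {m} _ → shell m) ⟩
  sum (map (λ _ → D + D) (oneTo N))                     ≡⟨ sum-map-oneTo-const N (λ _ → refl) ⟩
  N * (D + D)                                            ≡⟨ *-comm N (D + D) ⟩
  (D + D) * N                                            ∎
  where
  open ≤-Reasoning
  shell : ∀ m → (m + pred m) * (D ÷ m) ≤ D + D
  shell m = begin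
    (m + pred m) * (D ÷ m)       ≤⟨ *-monoˡ-≤ (D ÷ m) (+-monoʳ-≤ m pred[n]≤n) ⟩
    (m + m) * (D ÷ m)            ≡⟨ *-distribʳ-+ (D ÷ m) m m ⟩
    m * (D ÷ m) + m * (D ÷ m)    ≤⟨ +-mono-≤ m*q≤D m*q≤D ⟩
    D + D                        ∎
    where
    m*q≤D : m * (D ÷ m) ≤ D
    m*q≤D = subst (_≤ D) (*-comm (D ÷ m) m) (m÷n*n≤m D m)

-- The harmonic-type sum ∑_{d ≤ n} ⌊m / d⌋

sum-÷-odd : ∀ m k → sum (map (m ÷_) (oneTo (suc (k + k)))) ≤ m + sum (map (m ÷_) (oneTo k))
sum-÷-odd m zero    = ≤-reflexive (cong (_+ 0) (n/1≡n m))
sum-÷-odd m (suc k) = begin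
  m ÷ suc (2k′) + (m ÷ 2k′ + S (k + suc k))
    ≡⟨ cong (λ j → m ÷ suc (2k′) + (m ÷ 2k′ + S j)) (+-suc k k) ⟩
  m ÷ suc (2k′) + (m ÷ 2k′ + S (suc (k + k)))
    ≤⟨ +-mono-≤ (÷-antimonoʳ-≤ m z<s (n≤1+n 2k′)) (+-monoʳ-≤ (m ÷ 2k′) (sum-÷-odd m k)) ⟩
  m ÷ 2k′ + (m ÷ 2k′ + (m + S k))
    ≡⟨ solve 3 (λ a m s → a :+ (a :+ (m :+ s)) := m :+ (a :+ a :+ s)) refl (m ÷ 2k′) m (S k) ⟩
  m + (m ÷ 2k′ + m ÷ 2k′ + S k)
    ≤⟨ +-monoʳ-≤ m (+-monoˡ-≤ (S k) (m÷[k+k]+m÷[k+k]≤m÷k m (suc k))) ⟩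
  m + (m ÷ suc k + S k) ∎
  where
  open ≤-Reasoning
  open +-*-Solver
  S : ℕ → ℕ
  S n = sum (map (m ÷_) (oneTo n))
  2k′ = suc k + suc k

sum-÷-half : ∀ m n → sum (map (m ÷_) (oneTo n)) ≤ m + sum (map (m ÷_) (oneTo ⌊ n /2⌋))
sum-÷-half m n = ≤-trans (sum-map-oneTo-mono (m ÷_) n≤1+2h) (sum-÷-odd m h)
  where
  h = ⌊ n /2⌋
  n≤1+2h : n ≤ suc (h + h)
  n≤1+2h = begin
    n             ≡⟨ ⌊n/2⌋+⌈n/2⌉≡n n ⟨
    h + ⌈ n /2⌉   ≤⟨ +-monoʳ-≤ h (⌊n/2⌋-mono (n≤1+n (suc n))) ⟩
    h + suc h     ≡⟨ +-suc h h ⟩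
    suc (h + h)   ∎
    where open ≤-Reasoning

-- Induction along the accessibility proof on which ⌊log2⌋ recurses, so that ⌊log2⌋ unfolds definitionally.
sum-÷-≤-log2 : ∀ m n (rec : Acc _<_ n) → sum (map (m ÷_) (oneTo n)) ≤ m * suc (⌊log2⌋ n rec)
sum-÷-≤-log2 m zero          _        = z≤n
sum-÷-≤-log2 m (suc zero)    _        = ≤-reflexive (trans (cong (_+ 0) (n/1≡n m)) (sym (*-comm m 1)))
sum-÷-≤-log2 m (suc (suc n)) (acc rs) = begin
  sum (map (m ÷_) (oneTo (suc (suc n))))
    ≤⟨ sum-÷-half m (suc (suc n)) ⟩
  m + sum (map (m ÷_) (oneTo (suc ⌊ n /2⌋)))
    ≤⟨ +-monoʳ-≤ m (sum-÷-≤-log2 m (suc ⌊ n /2⌋) (rs (⌊n/2⌋<n (suc n)))) ⟩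
  m + m * suc (⌊log2⌋ (suc ⌊ n /2⌋) rec)
    ≡⟨ *-suc m _ ⟨
  m * suc (suc (⌊log2⌋ (suc ⌊ n /2⌋) rec)) ∎
  where
  open ≤-Reasoning
  rec = rs (⌊n/2⌋<n (suc n))

sum-÷-≤-log : ∀ m n → sum (map (m ÷_) (oneTo n)) ≤ m * suc ⌊log₂ n ⌋
sum-÷-≤-log m n = sum-÷-≤-log2 m n (<-wellFounded n)

-- The height sum as a sum of naturals

toℚᵘ-/ : ∀ i n .{{_ : NonZero n}} → toℚᵘ (i / n) ℚᵘ.≃ (i ℚᵘ./ n)
toℚᵘ-/ i (suc n) = ℚ.toℚᵘ-fromℚᵘ (mkℚᵘ i n)

*≤*⇒/≤/ : ∀ {a b m n} .{{_ : NonZero m}} .{{_ : NonZero n}} → a * n ≤ b * m → + a / m ℚ.≤ + b / n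
*≤*⇒/≤/ {a} {b} {m@(suc _)} {n@(suc _)} a*n≤b*m = ℚ.toℚᵘ-cancel-≤
  (ℚᵘ.≤-respˡ-≃ (ℚᵘ.≃-sym (toℚᵘ-/ (+ a) m)) (ℚᵘ.≤-respʳ-≃ (ℚᵘ.≃-sym (toℚᵘ-/ (+ b) n))
    (*≤* (subst₂ ℤ._≤_ (ℤ.pos-* a n) (ℤ.pos-* b m) (ℤ.+≤+ a*n≤b*m)))))

i/n+j/n≡[i+j]/n : ∀ i j n .{{_ : NonZero n}} → i / n ℚ.+ j / n ≡ (i ℤ.+ j) / n
i/n+j/n≡[i+j]/n i j n@(suc _) = ℚ.toℚᵘ-injective (begin
  toℚᵘ (i / n ℚ.+ j / n)                 ≈⟨ ℚ.toℚᵘ-homo-+ (i / n) (j / n) ⟩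
  toℚᵘ (i / n) ℚᵘ.+ toℚᵘ (j / n)         ≈⟨ ℚᵘ.+-cong (toℚᵘ-/ i n) (toℚᵘ-/ j n) ⟩
  (i ℚᵘ./ n) ℚᵘ.+ (j ℚᵘ./ n)             ≡⟨ cong (ℚᵘ._/ (n * n)) (sym (ℤ.*-distribʳ-+ (+ n) i j)) ⟩
  ((i ℤ.+ j) ℤ.* + n) ℚᵘ./ (n * n)       ≈⟨ ℚᵘ.*-cancelʳ-/ n ⟩
  (i ℤ.+ j) ℚᵘ./ n                        ≈⟨ toℚᵘ-/ (i ℤ.+ j) n ⟨
  toℚᵘ ((i ℤ.+ j) / n)                    ∎)
  where open ℚᵘ.≃-Reasoning

sumℚ-map-≤ : ∀ n .{{_ : NonZero n}} (f : A → ℚ) (g : A → ℕ) {xs} →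
             All (λ x → f x ℚ.≤ + g x / n) xs → sumℚ (map f xs) ℚ.≤ + sum (map g xs) / n
sumℚ-map-≤ n f g [] = ℚ.≤-reflexive (sym (ℚ.0/n≡0 n))
sumℚ-map-≤ n f g {x ∷ xs} (fx≤ ∷ fxs≤) = ℚ.≤-trans (ℚ.+-mono-≤ fx≤ (sumℚ-map-≤ n f g fxs≤))
  (ℚ.≤-reflexive (i/n+j/n≡[i+j]/n (+ g x) (+ sum (map g xs)) n))

m≤n⇒m∣n! : ∀ {m n} → 0 < m → m ≤ n → m ∣ n !
m≤n⇒m∣n! {suc m} _ m≤n = ∣-trans (m∣m*n (m !)) (m≤n⇒m!∣n! m≤n)

invH-≤ : ∀ r D .{{_ : NonZero D}} → H r ∣ D → invH r ℚ.≤ + (D ÷ H r) / D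
invH-≤ r D H∣D = *≤*⇒/≤/ {1} {D ÷ H r} {H r} {D} {{H-nonZero r}}
  (≤-reflexive (trans (*-identityˡ D) (sym (m÷n*n≡m H∣D))))

H-/ℤ-≤ : ∀ x y → y ≢ + 0 → H (x /ℤ y) ≤ ∣ x ∣ ⊔ ∣ y ∣
H-/ℤ-≤ x y y≢0 = ≤-trans (≤-reflexive (H-/ℤ x y))
  (Hℕ-≤ ∣ x ∣ ∣ y ∣ (n≢0⇒n>0 (y≢0 ∘ ℤ.∣i∣≡0⇒i≡0)))

heightSum-≤ : ∀ U D .{{_ : NonZero D}} → (∀ {h} → 0 < h → h ≤ U → h ∣ D) →
  ∀ {X} → All (λ x → x ≢ + 0 × ∣ x ∣ ≤ U) X →
  heightSum X ℚ.≤ + sum (map ((D ÷_) ∘ Hℕ ∘ Product.map ∣_∣ ∣_∣) (square X)) / D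
heightSum-≤ U D ≤U⇒∣D {X} X-bounded = ℚ.≤-trans
  (ℚ.≤-reflexive (cong sumℚ (concatMap-map≡map-cartesianProduct (λ x y → invH (x /ℤ y)) X X)))
  (sumℚ-map-≤ D _ _ (All.tabulate pair-≤))
  where
  pair-≤ : ∀ {z} → z ∈ square X → uncurry (λ x y → invH (x /ℤ y)) z ℚ.≤ + (D ÷ Hℕ (Product.map ∣_∣ ∣_∣ z)) / D
  pair-≤ {x , y} z∈ = subst (λ h → invH (x /ℤ y) ℚ.≤ + (D ÷ h) / D) (H-/ℤ x y)
    (invH-≤ (x /ℤ y) D (≤U⇒∣D (ℕ.>-nonZero⁻¹ _ {{H-nonZero (x /ℤ y)}}) H≤U))
    where
    x∈ = proj₁ (∈-cartesianProduct⁻ X X z∈)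
    y∈ = proj₂ (∈-cartesianProduct⁻ X X z∈)
    H≤U : H (x /ℤ y) ≤ U
    H≤U = ≤-trans (H-/ℤ-≤ x y (proj₁ (All.lookup X-bounded y∈)))
                  (⊔-lub (proj₂ (All.lookup X-bounded x∈)) (proj₂ (All.lookup X-bounded y∈)))

sum-height-weights-≤ : ∀ D U {X} → Unique X → All (λ x → x ≢ + 0 × ∣ x ∣ ≤ U) X →
  sum (map ((D ÷_) ∘ Hℕ ∘ Product.map ∣_∣ ∣_∣) (square X)) ≤ 8 * U * (1 + ⌊log₂ U ⌋) * D
sum-height-weights-≤ D U {X} X-unique X-bounded = begin
  sum (map ((D ÷_) ∘ Hℕ ∘ Product.map ∣_∣ ∣_∣) (square X))
    ≤⟨ sum-square-abs-≤ ((D ÷_) ∘ Hℕ) U X-unique X-bounded ⟩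
  4 * sum (map ((D ÷_) ∘ Hℕ) (square R))
    ≤⟨ *-monoʳ-≤ 4 (sum-square-Hℕ-≤-boxes (D ÷_) U) ⟩
  4 * sum (map (λ d → sum (map ((D ÷_) ∘ uncurry _⊔_) (square (oneTo (U ÷ d))))) R)
    ≤⟨ *-monoʳ-≤ 4 (sum-map-mono {xs = R} (All.tabulate λ {d} _ → sum-square-÷⊔-≤ D (U ÷ d))) ⟩
  4 * sum (map (λ d → (D + D) * (U ÷ d)) R)
    ≡⟨ cong (4 *_) (sum-map-*ˡ (D + D) (U ÷_) R) ⟩
  4 * ((D + D) * sum (map (U ÷_) R))
    ≤⟨ *-monoʳ-≤ 4 (*-monoʳ-≤ (D + D) (sum-÷-≤-log U U)) ⟩
  4 * ((D + D) * (U * suc ⌊log₂ U ⌋))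
    ≡⟨ solve 3 (λ d u l → con 4 :* ((d :+ d) :* (u :* (con 1 :+ l))) := con 8 :* u :* (con 1 :+ l) :* d) refl D U ⌊log₂ U ⌋ ⟩
  8 * U * (1 + ⌊log₂ U ⌋) * D ∎
  where
  open ≤-Reasoning
  open +-*-Solver
  R = oneTo U

heightSum≤8U[1+log₂U] : ∀ U {X} → Unique X → All (λ x → x ≢ + 0 × ∣ x ∣ ≤ U) X →
                         heightSum X ℚ.≤ + (8 * U * (1 + ⌊log₂ U ⌋)) / 1
heightSum≤8U[1+log₂U] U {X} X-unique X-bounded = ℚ.≤-trans (heightSum-≤ U (U !) m≤n⇒m∣n! X-bounded)
  (*≤*⇒/≤/ {N} {8 * U * (1 + ⌊log₂ U ⌋)} {U !} {1}
    (≤-trans (≤-reflexive (*-identityʳ N)) (sum-height-weights-≤ (U !) U X-unique X-bounded)))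
  where
  instance _ = U !≢0
  N = sum (map ((U ! ÷_) ∘ Hℕ ∘ Product.map ∣_∣ ∣_∣) (square X))

lemma11p5 : Σ ℕ λ C → (U : ℕ) → U ≥ 1 → (X : List ℤ) → Unique X
            → All (λ x → x ≢ + 0 × ∣ x ∣ ℕ.≤ U) X
            → heightSum X ℚ.≤ (+ (C * U * (1 ℕ.+ ⌊log₂ U ⌋)) / 1)
lemma11p5 = 8 , λ U _ X → heightSum≤8U[1+log₂U] U
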